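{- Let $k\ge1$ be a fixed integer with $k\ne4$. Then there exist constants $C$ and $N$ (depending on $k$) such that for all integers $n\ge N$, $\beta(P(n,k))\le n+\left\lceil\frac{n}{5}\right\rceil+C$.
   Context: $P(n,k)$ ($n>2k$) is the generalized Petersen graph with vertices $u_1,\dots,u_n,v_1,\dots,v_n$ and edges $u_iu_{i+1}$, $u_iv_i$, $v_iv_{i+k}$ (subscripts modulo $n$). $\beta(G)$ denotes the size of a minimum vertex cover of $G$. -}

module Defs where

open import Data.Nat using (ℕ; zero; suc; _+_; _*_; _≤_; _<_; NonZero; >-nonZero; z<s)
open import Data.Nat.Properties using (<-≤-trans; m≤m+n)
open import Data.Nat.DivMod using (_%_; _/_)
open import Data.Bool using (Bool; true; false; T; _∨_)
open import Data.Sum using (_⊎_; inj₁; inj₂)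
open import Data.Fin using (Fin; toℕ)
open import Data.Fin.Subset using (Subset; _∈_; ∣_∣)
open import Data.Product using (Σ; _×_; _,_)

-- Vertices of P(n,k): 2n of them, encoded as Fin (n + n):
-- index i (0 ≤ i < n) is u_i, index n + i is v_i.
-- Indices are 0-based, subscripts taken modulo n.

Covers : ∀ {m} → Subset m → (ℕ → ℕ → Set)
Covers {m} S a b = (Σ (Fin m) λ x → (toℕ x ≡′ a) × (x ∈ S)) ⊎ (Σ (Fin m) λ x → (toℕ x ≡′ b) × (x ∈ S))
  where
  open import Relation.Binary.PropositionalEquality renaming (_≡_ to _≡′_)

IsVertexCoverP : (n k : ℕ) .{{_ : NonZero n}} → Subset (n + n) → Set
IsVertexCoverP n k S =
  (i : ℕ) → i < n →
    Covers S i ((i + 1) % n)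
  × Covers S i (n + i)
  × Covers S (n + i) (n + ((i + k) % n))

βP≤ : (n k : ℕ) .{{_ : NonZero n}} → ℕ → Set
βP≤ n k b = Σ (Subset (n + n)) λ S → IsVertexCoverP n k S × (∣ S ∣ ≤ b)

βPet : (n k : ℕ) → 2 * k < n → ℕ → Set
βPet n k h b = βP≤ n k {{>-nonZero (<-≤-trans z<s h)}} b

⌈_/5⌉ : ℕ → ℕ
⌈ n /5⌉ = (n + 4) / 5

module Submission where

-- A vertex cover is the complement of an independent set, so we describe an
-- independent set column by column: column j of P(n,k) is the pair u_j, v_j,
-- and its Role says whether u_j, v_j or neither is left out of the cover.
-- A CoverPattern for k is an infinite sequence of roles in which no two
-- consecutive columns drop u, no two columns at distance k drop v, and every
-- aligned block of five columns drops nothing at most once.  Truncating such a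
-- pattern to the first n ∸ k columns avoids the wrap-around edges, and the
-- resulting cover has n + k + (number of idle columns) ≤ n + ⌈n/5⌉ + k vertices.
--
-- Patterns are read off a five-spoked "wheel" of roles along the labels
-- j + s * ⌊j/k⌋ taken mod 5, where the shift s is 0 when 5 ∤ k and 3 when
-- 5 ∣ k (so that the label always moves by a non-zero residue over a jump of
-- length k).

open import Defs
open import Data.Nat using (ℕ; _+_; _*_; _≤_; _<_)
open import Data.Product using (Σ)
open import Relation.Nullary using (¬_)
open import Relation.Binary.PropositionalEquality using (_≡_)

open import Data.Nat using (zero; suc; _∸_; NonZero; >-nonZero; >-nonZero⁻¹; z≤n; s≤s; z<s)
open import Data.Nat.Properties
open import Data.Nat.DivMod
open import Data.Nat.Divisibility using (∣-refl; n∣m*n; m∣m*n)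
open import Data.Nat.Tactic.RingSolver using (solve-∀)
open import Data.Bool using (Bool; true; false; _∨_)
open import Data.Bool.Properties using (∨-zeroʳ)
open import Data.Product using (_,_; _×_)
open import Data.Sum using (_⊎_; inj₁; inj₂)
open import Data.Fin using (Fin; toℕ; fromℕ<; _↑ˡ_; _↑ʳ_)
open import Data.Fin.Properties using (toℕ-fromℕ<; toℕ-↑ˡ; toℕ-↑ʳ)
open import Data.Fin.Subset using (Subset; _∈_; ∣_∣)
open import Data.Vec using (tabulate; lookup; _++_; _∷_; [])
open import Data.Vec.Properties using (lookup⇒[]=; lookup∘tabulate; lookup-++ˡ; lookup-++ʳ)
open import Relation.Nullary using (yes; no; contradiction)
open import Relation.Binary.PropositionalEquality using (refl; sym; trans; cong; cong₂; subst; _≢_; module ≡-Reasoning)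

Σ< : ℕ → (ℕ → ℕ) → ℕ
Σ< zero    f = 0
Σ< (suc m) f = f 0 + Σ< m (λ j → f (suc j))

Σ<-split : ∀ m d f → Σ< (m + d) f ≡ Σ< m f + Σ< d (λ j → f (m + j))
Σ<-split zero    d f = refl
Σ<-split (suc m) d f =
  trans (cong (f 0 +_) (Σ<-split m d (λ j → f (suc j)))) (sym (+-assoc (f 0) _ _))

Σ<-cong : ∀ m {f g} → (∀ j → j < m → f j ≡ g j) → Σ< m f ≡ Σ< m g
Σ<-cong zero    _   = refl
Σ<-cong (suc m) f≡g = cong₂ _+_ (f≡g 0 z<s) (Σ<-cong m (λ j j<m → f≡g (suc j) (s≤s j<m)))

Σ<-+ : ∀ m f g → Σ< m (λ j → f j + g j) ≡ Σ< m f + Σ< m g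
Σ<-+ zero    f g = refl
Σ<-+ (suc m) f g =
  trans (cong (f 0 + g 0 +_) (Σ<-+ m (λ j → f (suc j)) (λ j → g (suc j)))) (interchange (f 0) (g 0) (Σ< m (λ j → f (suc j))) (Σ< m (λ j → g (suc j))))
  where
  interchange : ∀ a b c d → a + b + (c + d) ≡ a + c + (b + d)
  interchange = solve-∀

Σ<-const : ∀ m c → Σ< m (λ _ → c) ≡ m * c
Σ<-const zero    c = refl
Σ<-const (suc m) c = cong (c +_) (Σ<-const m c)

Σ<-mono : ∀ {m m′} f → m ≤ m′ → Σ< m f ≤ Σ< m′ f
Σ<-mono {m} {m′} f m≤m′ = begin
  Σ< m f                                   ≤⟨ m≤m+n (Σ< m f) _ ⟩
  Σ< m f + Σ< (m′ ∸ m) (λ j → f (m + j))   ≡⟨ Σ<-split m (m′ ∸ m) f ⟨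
  Σ< (m + (m′ ∸ m)) f                      ≡⟨ cong (λ l → Σ< l f) (m+[n∸m]≡n m≤m′) ⟩
  Σ< m′ f                                  ∎
  where open ≤-Reasoning

Σ<-blocks : ∀ b c Q f → (∀ q → Σ< b (λ r → f (q * b + r)) ≤ c) → Σ< (Q * b) f ≤ Q * c
Σ<-blocks b c zero    f block = z≤n
Σ<-blocks b c (suc Q) f block = begin
  Σ< (b + Q * b) f                          ≡⟨ Σ<-split b (Q * b) f ⟩
  Σ< b f + Σ< (Q * b) (λ j → f (b + j))     ≤⟨ +-mono-≤ (block 0) (Σ<-blocks b c Q _ later) ⟩
  c + Q * c                                 ∎
  where
  open ≤-Reasoning
  later : ∀ q → Σ< b (λ r → f (b + (q * b + r))) ≤ c
  later q = subst (_≤ c) (Σ<-cong b (λ r _ → cong f (+-assoc b (q * b) r))) (block (suc q))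

m≤⌈m/5⌉*5 : ∀ m → m ≤ ⌈ m /5⌉ * 5
m≤⌈m/5⌉*5 m = +-cancelʳ-≤ 4 m (⌈ m /5⌉ * 5) (begin
  m + 4                        ≡⟨ m≡m%n+[m/n]*n (m + 4) 5 ⟩
  (m + 4) % 5 + ⌈ m /5⌉ * 5    ≤⟨ +-monoˡ-≤ (⌈ m /5⌉ * 5) (≤-pred (m%n<n (m + 4) 5)) ⟩
  4 + ⌈ m /5⌉ * 5              ≡⟨ +-comm 4 _ ⟩
  ⌈ m /5⌉ * 5 + 4              ∎)
  where open ≤-Reasoning

Σ<-⌈/5⌉ : ∀ m f → (∀ q → Σ< 5 (λ r → f (q * 5 + r)) ≤ 1) → Σ< m f ≤ ⌈ m /5⌉
Σ<-⌈/5⌉ m f block = begin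
  Σ< m f                  ≤⟨ Σ<-mono f (m≤⌈m/5⌉*5 m) ⟩
  Σ< (⌈ m /5⌉ * 5) f      ≤⟨ Σ<-blocks 5 1 ⌈ m /5⌉ f block ⟩
  ⌈ m /5⌉ * 1             ≡⟨ *-identityʳ _ ⟩
  ⌈ m /5⌉                 ∎
  where open ≤-Reasoning

bit : Bool → ℕ
bit true  = 1
bit false = 0

∣++∣ : ∀ {m n} (xs : Subset m) (ys : Subset n) → ∣ xs ++ ys ∣ ≡ ∣ xs ∣ + ∣ ys ∣
∣++∣ []           ys = refl
∣++∣ (true ∷ xs)  ys = cong suc (∣++∣ xs ys)
∣++∣ (false ∷ xs) ys = ∣++∣ xs ys

∣tabulate∣ : ∀ m (f : ℕ → Bool) → ∣ tabulate {n = m} (λ i → f (toℕ i)) ∣ ≡ Σ< m (λ j → bit (f j))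
∣tabulate∣ zero    f = refl
∣tabulate∣ (suc m) f with f 0
... | true  = cong suc (∣tabulate∣ m (λ j → f (suc j)))
... | false = ∣tabulate∣ m (λ j → f (suc j))

-- Column roles: which vertex of the column {u_j , v_j} is left out of the
-- cover (an independent set takes at most one vertex of each spoke).

data Role : Set where
  dropU dropV keepBoth : Role

keepsU keepsV : Role → Bool
keepsU dropU = false
keepsU _     = true
keepsV dropV = false
keepsV _     = true

weight : Role → ℕ
weight x = bit (keepsU x) + bit (keepsV x)

idle : Role → ℕ
idle keepBoth = 1
idle _        = 0

weight≡1+idle : ∀ x → weight x ≡ 1 + idle x
weight≡1+idle dropU    = refl
weight≡1+idle dropV    = refl
weight≡1+idle keepBoth = refl

keptU keptV : ∀ n → (ℕ → Role) → Subset n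
keptU n r = tabulate (λ i → keepsU (r (toℕ i)))
keptV n r = tabulate (λ i → keepsV (r (toℕ i)))

coverSet : ∀ n → (ℕ → Role) → Subset (n + n)
coverSet n r = keptU n r ++ keptV n r

module _ {n : ℕ} (r : ℕ → Role) {i : ℕ} (i<n : i < n) where

  u∈coverSet : keepsU (r i) ≡ true → Σ (Fin (n + n)) λ x → (toℕ x ≡ i) × (x ∈ coverSet n r)
  u∈coverSet kept = x ↑ˡ n , trans (toℕ-↑ˡ x n) (toℕ-fromℕ< i<n) , lookup⇒[]= (x ↑ˡ n) _ (begin
    lookup (coverSet n r) (x ↑ˡ n)   ≡⟨ lookup-++ˡ (keptU n r) (keptV n r) x ⟩
    lookup (tabulate _) x           ≡⟨ lookup∘tabulate _ x ⟩
    keepsU (r (toℕ x))              ≡⟨ cong (λ j → keepsU (r j)) (toℕ-fromℕ< i<n) ⟩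
    keepsU (r i)                    ≡⟨ kept ⟩
    true                            ∎)
    where
    open ≡-Reasoning
    x = fromℕ< i<n

  v∈coverSet : keepsV (r i) ≡ true → Σ (Fin (n + n)) λ x → (toℕ x ≡ n + i) × (x ∈ coverSet n r)
  v∈coverSet kept = n ↑ʳ x , trans (toℕ-↑ʳ n x) (cong (n +_) (toℕ-fromℕ< i<n)) , lookup⇒[]= (n ↑ʳ x) _ (begin
    lookup (coverSet n r) (n ↑ʳ x)   ≡⟨ lookup-++ʳ (keptU n r) (keptV n r) x ⟩
    lookup (tabulate _) x           ≡⟨ lookup∘tabulate _ x ⟩
    keepsV (r (toℕ x))              ≡⟨ cong (λ j → keepsV (r j)) (toℕ-fromℕ< i<n) ⟩
    keepsV (r i)                    ≡⟨ kept ⟩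
    true                            ∎)
    where
    open ≡-Reasoning
    x = fromℕ< i<n

-- coverSet is a vertex cover as soon as every rim edge keeps a u-end and
-- every inner edge keeps a v-end (spokes are covered automatically, since a
-- column never drops both of its vertices).
coverSet-covers : ∀ n k .{{_ : NonZero n}} (r : ℕ → Role) →
  (∀ i → i < n → keepsU (r i) ∨ keepsU (r ((i + 1) % n)) ≡ true) →
  (∀ i → i < n → keepsV (r i) ∨ keepsV (r ((i + k) % n)) ≡ true) →
  IsVertexCoverP n k (coverSet n r)
coverSet-covers n k r rim inner i i<n = rimEdge , spoke , innerEdge
  where
  rimEdge : Covers (coverSet n r) i ((i + 1) % n)
  rimEdge with keepsU (r i) in kept
  ... | true  = inj₁ (u∈coverSet r i<n kept)
  ... | false = inj₂ (u∈coverSet r (m%n<n (i + 1) n) (trans (sym (cong (_∨ keepsU (r ((i + 1) % n))) kept)) (rim i i<n)))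

  spoke : Covers (coverSet n r) i (n + i)
  spoke with r i in ri
  ... | dropU    = inj₂ (v∈coverSet r i<n (cong keepsV ri))
  ... | dropV    = inj₁ (u∈coverSet r i<n (cong keepsU ri))
  ... | keepBoth = inj₁ (u∈coverSet r i<n (cong keepsU ri))

  innerEdge : Covers (coverSet n r) (n + i) (n + ((i + k) % n))
  innerEdge with keepsV (r i) in kept
  ... | true  = inj₁ (v∈coverSet r i<n kept)
  ... | false = inj₂ (v∈coverSet r (m%n<n (i + k) n) (trans (sym (cong (_∨ keepsV (r ((i + k) % n))) kept)) (inner i i<n)))

∣coverSet∣ : ∀ n r → ∣ coverSet n r ∣ ≡ Σ< n (λ j → weight (r j))
∣coverSet∣ n r = begin
  ∣ coverSet n r ∣
    ≡⟨ ∣++∣ (keptU n r) (keptV n r) ⟩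
  ∣ keptU n r ∣ + ∣ keptV n r ∣
    ≡⟨ cong₂ _+_ (∣tabulate∣ n (λ j → keepsU (r j))) (∣tabulate∣ n (λ j → keepsV (r j))) ⟩
  Σ< n (λ j → bit (keepsU (r j))) + Σ< n (λ j → bit (keepsV (r j)))
    ≡⟨ Σ<-+ n _ _ ⟨
  Σ< n (λ j → weight (r j))
    ∎
  where open ≡-Reasoning

-- Cover patterns: an infinite column assignment describing an independent
-- set of the "unrolled" graph P(∞,k), with few idle columns.

record CoverPattern (k : ℕ) : Set where
  field
    role   : ℕ → Role
    rimU   : ∀ i → keepsU (role i) ∨ keepsU (role (suc i)) ≡ true
    innerV : ∀ i → keepsV (role i) ∨ keepsV (role (i + k)) ≡ true
    sparse : ∀ q → Σ< 5 (λ r → idle (role (q * 5 + r))) ≤ 1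

truncate : ℕ → (ℕ → Role) → ℕ → Role
truncate M p j with j <? M
... | yes _ = p j
... | no _  = keepBoth

truncate-below : ∀ {M} p {j} → j < M → truncate M p j ≡ p j
truncate-below {M} p {j} j<M with j <? M
... | yes _   = refl
... | no j≮M  = contradiction j<M j≮M

truncate-above : ∀ M p j → truncate M p (M + j) ≡ keepBoth
truncate-above M p j with M + j <? M
... | yes M+j<M = contradiction M+j<M (m+n≮m M j)
... | no _      = refl

truncate-edge : (K : Role → Bool) → K keepBoth ≡ true → ∀ M p a b →
  (a < M → K (p a) ∨ K (p b) ≡ true) → K (truncate M p a) ∨ K (truncate M p b) ≡ true
truncate-edge K idleK M p a b edge with a <? M | b <? M
... | no _    | _     rewrite idleK = refl
... | yes a<M | yes _ = edge a<M
... | yes _   | no _  rewrite idleK = ∨-zeroʳ (K (p a))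

truncate-weight : ∀ M k p →
  Σ< (M + k) (λ j → weight (truncate M p j)) ≡ M + Σ< M (λ j → idle (p j)) + k * 2
truncate-weight M k p = begin
  Σ< (M + k) (λ j → weight (truncate M p j))
    ≡⟨ Σ<-split M k _ ⟩
  Σ< M (λ j → weight (truncate M p j)) + Σ< k (λ j → weight (truncate M p (M + j)))
    ≡⟨ cong₂ _+_ (Σ<-cong M (λ j j<M → trans (cong weight (truncate-below p j<M)) (weight≡1+idle (p j))))
                 (Σ<-cong k (λ j _ → cong weight (truncate-above M p j))) ⟩
  Σ< M (λ j → 1 + idle (p j)) + Σ< k (λ _ → 2)
    ≡⟨ cong₂ _+_ (Σ<-+ M (λ _ → 1) (λ j → idle (p j))) (Σ<-const k 2) ⟩
  Σ< M (λ _ → 1) + Σ< M (λ j → idle (p j)) + k * 2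
    ≡⟨ cong (λ t → t + Σ< M (λ j → idle (p j)) + k * 2) (trans (Σ<-const M 1) (*-identityʳ M)) ⟩
  M + Σ< M (λ j → idle (p j)) + k * 2
    ∎
  where open ≡-Reasoning

pattern-bound : ∀ n k .{{_ : NonZero n}} → 1 ≤ k → k < n → CoverPattern k →
  βP≤ n k (n + ⌈ n /5⌉ + k)
pattern-bound n k 1≤k k<n P = coverSet n r , coverSet-covers n k r rim inner , size
  where
  open CoverPattern P
  M = n ∸ k
  r = truncate M role

  M+k≡n : M + k ≡ n
  M+k≡n = m∸n+n≡m (<⇒≤ k<n)

  no-wrap : ∀ {i} j → i < M → j ≤ k → (i + j) % n ≡ i + j
  no-wrap {i} j i<M j≤k = m<n⇒m%n≡m (subst (i + j <_) M+k≡n (+-mono-<-≤ i<M j≤k))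

  rim : ∀ i → i < n → keepsU (r i) ∨ keepsU (r ((i + 1) % n)) ≡ true
  rim i _ = truncate-edge keepsU refl M role i ((i + 1) % n) λ i<M →
    subst (λ j → keepsU (role i) ∨ keepsU (role j) ≡ true)
          (sym (trans (no-wrap 1 i<M 1≤k) (+-comm i 1))) (rimU i)

  inner : ∀ i → i < n → keepsV (r i) ∨ keepsV (r ((i + k) % n)) ≡ true
  inner i _ = truncate-edge keepsV refl M role i ((i + k) % n) λ i<M →
    subst (λ j → keepsV (role i) ∨ keepsV (role j) ≡ true)
          (sym (no-wrap k i<M ≤-refl)) (innerV i)

  size : ∣ coverSet n r ∣ ≤ n + ⌈ n /5⌉ + k
  size = begin
    ∣ coverSet n r ∣                                                ≡⟨ ∣coverSet∣ n r ⟩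
    Σ< n (λ j → weight (r j))                                      ≡⟨ cong (λ l → Σ< l (λ j → weight (r j))) M+k≡n ⟨
    Σ< (M + k) (λ j → weight (r j))                                ≡⟨ truncate-weight M k role ⟩
    M + Σ< M (λ j → idle (role j)) + k * 2                         ≤⟨ +-monoˡ-≤ (k * 2) (+-monoʳ-≤ M (Σ<-⌈/5⌉ M _ sparse)) ⟩
    M + ⌈ M /5⌉ + k * 2                                            ≤⟨ +-monoˡ-≤ (k * 2) (+-monoʳ-≤ M (/-monoˡ-≤ 5 (+-monoˡ-≤ 4 (m∸n≤m n k)))) ⟩
    M + ⌈ n /5⌉ + k * 2                                            ≡⟨ arrange M ⌈ n /5⌉ k ⟩
    (M + k) + ⌈ n /5⌉ + k                                          ≡⟨ cong (λ l → l + ⌈ n /5⌉ + k) M+k≡n ⟩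
    n + ⌈ n /5⌉ + k                                                ∎
    where
    open ≤-Reasoning
    arrange : ∀ m x k → m + x + k * 2 ≡ (m + k) + x + k
    arrange = solve-∀

quotient-jump : ∀ i k .{{_ : NonZero k}} → (i + k) / k ≡ suc (i / k)
quotient-jump i k = begin
  (i + k) / k      ≡⟨ +-distrib-/-∣ʳ i ∣-refl ⟩
  i / k + k / k    ≡⟨ cong (i / k +_) (n/n≡1 k) ⟩
  i / k + 1        ≡⟨ +-comm (i / k) 1 ⟩
  suc (i / k)      ∎
  where open ≡-Reasoning

quotient-step : ∀ i k .{{_ : NonZero k}} → suc i / k ≡ i / k ⊎ suc i / k ≡ suc (i / k)
quotient-step i k with m≤n⇒m<n∨m≡n (≤-trans (/-monoˡ-≤ k suc-i≤i+k) (≤-reflexive (quotient-jump i k)))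
  where
  suc-i≤i+k : suc i ≤ i + k
  suc-i≤i+k = subst (_≤ i + k) (+-comm i 1) (+-monoʳ-≤ i (>-nonZero⁻¹ k))
... | inj₁ below = inj₁ (≤-antisym (≤-pred below) (/-monoˡ-≤ k (n≤1+n i)))
... | inj₂ top   = inj₂ top

block-quotient : ∀ b m q {r} .{{_ : NonZero b}} .{{_ : NonZero m}} .{{_ : NonZero (b * m)}} →
  r < b → (q * b + r) / (b * m) ≡ q / m
block-quotient b m q {r} r<b = begin
  (q * b + r) / (b * m)      ≡⟨ m/n/o≡m/[n*o] (q * b + r) b m ⟨
  (q * b + r) / b / m        ≡⟨ cong (_/ m) block-index ⟩
  q / m                      ∎
  where
  open ≡-Reasoning
  block-index : (q * b + r) / b ≡ q
  block-index = begin
    (q * b + r) / b          ≡⟨ +-distrib-/-∣ˡ r (n∣m*n q) ⟩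
    q * b / b + r / b        ≡⟨ cong₂ _+_ (m*n/n≡m q b) (m<n⇒m/n≡0 r<b) ⟩
    q + 0                    ≡⟨ +-identityʳ q ⟩
    q                        ∎

-- The wheel: roles of the five residues mod 5.  Residues 0 and 2 drop u (they
-- are not adjacent, even when a step moves by 4 instead of 1); two further
-- residues drop v, chosen not to differ by the residue d of a jump of
-- length k: {1,3} when d ≡ ±1 ("near"), {3,4} when d ≡ ±2.

near : ℕ → Bool
near 1 = true
near 4 = true
near _ = false

wheel : Bool → ℕ → Role
wheel _     0 = dropU
wheel true  1 = dropV
wheel false 1 = keepBoth
wheel _     2 = dropU
wheel _     3 = dropV
wheel true  4 = keepBoth
wheel false 4 = dropV
wheel _     _ = keepBoth

fin5 : {P : ℕ → Set} → P 0 → P 1 → P 2 → P 3 → P 4 → ∀ x → x < 5 → P x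
fin5 p₀ p₁ p₂ p₃ p₄ 0 _ = p₀
fin5 p₀ p₁ p₂ p₃ p₄ 1 _ = p₁
fin5 p₀ p₁ p₂ p₃ p₄ 2 _ = p₂
fin5 p₀ p₁ p₂ p₃ p₄ 3 _ = p₃
fin5 p₀ p₁ p₂ p₃ p₄ 4 _ = p₄
fin5 p₀ p₁ p₂ p₃ p₄ (suc (suc (suc (suc (suc _))))) (s≤s (s≤s (s≤s (s≤s (s≤s ())))))

wheel-rim : ∀ b e → e ≡ 1 ⊎ e ≡ 4 → ∀ x → x < 5 →
  keepsU (wheel b x) ∨ keepsU (wheel b ((x + e) % 5)) ≡ true
wheel-rim true  _ (inj₁ refl) = fin5 refl refl refl refl refl
wheel-rim true  _ (inj₂ refl) = fin5 refl refl refl refl refl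
wheel-rim false _ (inj₁ refl) = fin5 refl refl refl refl refl
wheel-rim false _ (inj₂ refl) = fin5 refl refl refl refl refl

wheel-inner : ∀ d → d < 5 → d ≢ 0 → ∀ x → x < 5 →
  keepsV (wheel (near d) x) ∨ keepsV (wheel (near d) ((x + d) % 5)) ≡ true
wheel-inner = fin5 (λ 0≢0 → contradiction refl 0≢0)
  (λ _ → fin5 refl refl refl refl refl) (λ _ → fin5 refl refl refl refl refl)
  (λ _ → fin5 refl refl refl refl refl) (λ _ → fin5 refl refl refl refl refl)

wheel-sparse : ∀ b c → c < 5 → Σ< 5 (λ r → idle (wheel b ((r % 5 + c) % 5))) ≤ 1
wheel-sparse true  = fin5 (s≤s z≤n) (s≤s z≤n) (s≤s z≤n) (s≤s z≤n) (s≤s z≤n)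
wheel-sparse false = fin5 (s≤s z≤n) (s≤s z≤n) (s≤s z≤n) (s≤s z≤n) (s≤s z≤n)

-- The shift s is 0 when
-- 5 ∤ k; when 5 ∣ k the shift 3 makes the label advance by 3 (mod 5) over a
-- jump of length k, while blocks of five stay aligned.

data Shift (k : ℕ) : ℕ → Set where
  unshifted : k % 5 ≢ 0 → Shift k 0
  shifted   : ∀ m → k ≡ 5 * suc m → Shift k 3

shift : ∀ k → 1 ≤ k → Σ ℕ (Shift k)
shift k 1≤k with k % 5 ≟ 0
... | no k%5≢0 = 0 , unshifted k%5≢0
... | yes k%5≡0 with k / 5 in k/5
...   | zero  = contradiction (subst (1 ≤_) k≡[k/5]*5 1≤k) λ ()
  where
  k≡[k/5]*5 : k ≡ 0
  k≡[k/5]*5 = trans (m≡m%n+[m/n]*n k 5) (cong₂ _+_ k%5≡0 (cong (_* 5) k/5))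
...   | suc m = 3 , shifted m (trans (m≡m%n+[m/n]*n k 5) (trans (cong₂ _+_ k%5≡0 (cong (_* 5) k/5)) (*-comm (suc m) 5)))

label : ∀ k .{{_ : NonZero k}} → ℕ → ℕ → ℕ
label k s i = i + s * (i / k)

label-jump : ∀ k .{{_ : NonZero k}} s i → label k s (i + k) ≡ label k s i + (k + s)
label-jump k s i = trans (cong (λ t → i + k + s * t) (quotient-jump i k)) (arrange i k s (i / k))
  where
  arrange : ∀ i k s x → i + k + s * suc x ≡ i + s * x + (k + s)
  arrange = solve-∀

jump-residue≢0 : ∀ {k s} → Shift k s → (k + s) % 5 ≢ 0
jump-residue≢0 {k} (unshifted k%5≢0) = subst (λ t → t % 5 ≢ 0) (sym (+-identityʳ k)) k%5≢0
jump-residue≢0 (shifted m refl) rewrite %-remove-+ˡ 3 {5} (m∣m*n (suc m)) = λ ()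

label-step : ∀ {k s} .{{_ : NonZero k}} → Shift k s → ∀ i →
  label k s (suc i) ≡ label k s i + 1 ⊎ label k s (suc i) ≡ label k s i + 4
label-step (unshifted _) i = inj₁ (unshifted-step i)
  where
  unshifted-step : ∀ i → suc i + 0 ≡ i + 0 + 1
  unshifted-step = solve-∀
label-step {k} (shifted _ _) i with quotient-step i k
... | inj₁ same rewrite same = inj₁ (+-comm 1 (i + 3 * (i / k)))
... | inj₂ next rewrite next = inj₂ (shifted-step i (i / k))
  where
  shifted-step : ∀ i x → suc i + 3 * suc x ≡ i + 3 * x + 4
  shifted-step = solve-∀

label-block : ∀ {k s} .{{_ : NonZero k}} → Shift k s → ∀ q {r} → r < 5 →
  label k s (q * 5 + r) ≡ r + label k s (q * 5)
label-block (unshifted _) q {r} _ = arrange (q * 5) r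
  where
  arrange : ∀ a r → a + r + 0 ≡ r + (a + 0)
  arrange = solve-∀
label-block (shifted m refl) q {r} r<5 = begin
  q * 5 + r + 3 * ((q * 5 + r) / (5 * suc m))   ≡⟨ cong (λ t → q * 5 + r + 3 * t) same-quotient ⟩
  q * 5 + r + 3 * ((q * 5) / (5 * suc m))       ≡⟨ arrange (q * 5) r _ ⟩
  r + (q * 5 + 3 * ((q * 5) / (5 * suc m)))     ∎
  where
  open ≡-Reasoning
  arrange : ∀ a r x → a + r + x ≡ r + (a + x)
  arrange = solve-∀
  same-quotient : (q * 5 + r) / (5 * suc m) ≡ (q * 5) / (5 * suc m)
  same-quotient = trans (block-quotient 5 (suc m) q r<5)
    (sym (trans (cong (_/ (5 * suc m)) (sym (+-identityʳ (q * 5)))) (block-quotient 5 (suc m) q z<s)))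

wheelPattern : ∀ k .{{_ : NonZero k}} {s} → Shift k s → CoverPattern k
wheelPattern k {s} σ = record { role = role ; rimU = rimU ; innerV = innerV ; sparse = sparse }
  where
  d = (k + s) % 5
  ℓ = label k s

  role : ℕ → Role
  role i = wheel (near d) (ℓ i % 5)

  advanced : ∀ {i j} e → ℓ j ≡ ℓ i + e → ℓ j % 5 ≡ (ℓ i % 5 + e % 5) % 5
  advanced {i} e ℓj≡ℓi+e = trans (cong (_% 5) ℓj≡ℓi+e) (%-distribˡ-+ (ℓ i) e 5)

  rimU : ∀ i → keepsU (role i) ∨ keepsU (role (suc i)) ≡ true
  rimU i with label-step σ i
  ... | inj₁ step = subst (λ y → keepsU (role i) ∨ keepsU (wheel (near d) y) ≡ true) (sym (advanced {i} 1 step))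
                      (wheel-rim (near d) 1 (inj₁ refl) (ℓ i % 5) (m%n<n (ℓ i) 5))
  ... | inj₂ step = subst (λ y → keepsU (role i) ∨ keepsU (wheel (near d) y) ≡ true) (sym (advanced {i} 4 step))
                      (wheel-rim (near d) 4 (inj₂ refl) (ℓ i % 5) (m%n<n (ℓ i) 5))

  innerV : ∀ i → keepsV (role i) ∨ keepsV (role (i + k)) ≡ true
  innerV i = subst (λ y → keepsV (role i) ∨ keepsV (wheel (near d) y) ≡ true)
    (sym (advanced {i} (k + s) (label-jump k s i)))
    (wheel-inner d (m%n<n (k + s) 5) (jump-residue≢0 σ) (ℓ i % 5) (m%n<n (ℓ i) 5))

  sparse : ∀ q → Σ< 5 (λ r → idle (role (q * 5 + r))) ≤ 1
  sparse q = subst (_≤ 1) (Σ<-cong 5 rotated) (wheel-sparse (near d) (ℓ (q * 5) % 5) (m%n<n (ℓ (q * 5)) 5))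
    where
    rotated : ∀ r → r < 5 → idle (wheel (near d) ((r % 5 + ℓ (q * 5) % 5) % 5)) ≡ idle (role (q * 5 + r))
    rotated r r<5 = cong (λ y → idle (wheel (near d) y))
      (sym (trans (cong (_% 5) (label-block σ q r<5)) (%-distribˡ-+ r (ℓ (q * 5)) 5)))

proposition21 : (k : ℕ) → 1 ≤ k → ¬ (k ≡ 4) →
    Σ ℕ λ C → Σ ℕ λ N → (n : ℕ) → N ≤ n → (h : 2 * k < n) →
      βPet n k h (n + ⌈ n /5⌉ + C)
proposition21 k 1≤k _ = k , 0 , λ n _ 2k<n →
  let instance
        k≢0 : NonZero k
        k≢0 = >-nonZero 1≤k
        n≢0 : NonZero n
        n≢0 = >-nonZero (<-≤-trans z<s 2k<n)
      k<n : k < n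
      k<n = <-≤-trans (s≤s (m≤m+n k (k + 0))) 2k<n
      (_ , σ) = shift k 1≤k
  in pattern-bound n k 1≤k k<n (wheelPattern k σ)
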